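{- Let $t\ge 2$ and consider an edge coloring of the complete graph $K_n$ with colors $\{1,\ldots,t\}$, with color classes $H_1,\ldots,H_t$ (spanning subgraphs of $K_n$), such that $H_j$ is a regular graph for every $j\geq 3$. Let $u,v,x_0$ be distinct vertices with $vx_{0}\in E(H_{1})$ and $x_{0}u\notin E(H_{1})$. If $L$ is a $vx_0$ and $x_0u$ exchange, then there exists a simplified $vx_{0}$ and $x_{0}u$ exchange $L'$ with $\mathcal{X}(L')\subseteq \mathcal{X}(L)$.
   Context: For distinct vertices $u,v$ and a vertex $x_0$, a $vx_0$ and $x_0u$ exchange is a list of $2l$ distinct edges of $K_n$ of the form $L=(vx_{0},x_{0}u,vx_{1},x_{1}u,\ldots,vx_{l-1},x_{l-1}u)$ (for some $l\ge1$) such that $x_{i}u$ and $vx_{i+1}$ have the same color for all $i$, indices taken modulo $l$ (so $x_{l-1}u$ and $vx_0$ have the same color). We write $\mathcal{X}(L)=\{x_{0},\ldots,x_{l-1}\}$. The exchange is simplified if for every color class $H_i$ there is at most one $x_{j}\in \mathcal{X}(L)$ with $vx_{j}\in E(H_{i})$. -}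

module Defs where

open import Data.Nat using (ℕ; zero; suc; _≤_; _<_; NonZero)
open import Data.Nat.DivMod using (_%_; m%n<n)
open import Data.Fin using (Fin; toℕ; fromℕ<)
open import Data.Fin.Properties using (_≟_)
open import Data.Nat.Properties using () renaming (_≟_ to _≟ℕ_)
open import Data.List using (List; length; filter; allFin)
open import Data.Product using (Σ; ∃; _×_; _,_)
open import Relation.Nullary using (¬_)
open import Relation.Nullary.Decidable using (¬?; _×-dec_)
open import Relation.Binary.PropositionalEquality using (_≡_; _≢_)
open import Function.Definitions using (Injective)

-- An edge colouring with colours {1,…,t} is a
-- symmetric function c on ordered pairs of vertices; only its values on pairs
-- of distinct vertices matter, and these lie in {1,…,t}.
record EdgeColoring (n t : ℕ) : Set where
  field
    col   : Fin n → Fin n → ℕ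
    sym   : ∀ x y → col x y ≡ col y x
    range : ∀ x y → x ≢ y → (1 ≤ col x y) × (col x y ≤ t)
open EdgeColoring public

degree : ∀ {n t} → EdgeColoring n t → ℕ → Fin n → ℕ
degree {n} c j x =
  length (filter (λ y → ¬? (y ≟ x) ×-dec (col c x y ≟ℕ j)) (allFin n))

IsRegularClass : ∀ {n t} → EdgeColoring n t → ℕ → Set
IsRegularClass {n} c j = ∃ λ d → (x : Fin n) → degree c j x ≡ d

next : ∀ {k} → Fin (suc k) → Fin (suc k)
next {k} i = fromℕ< (m%n<n (suc (toℕ i)) (suc k))

-- A vx₀ and x₀u exchange L = (vx₀, x₀u, vx₁, x₁u, …, vx_{l-1}, x_{l-1}u),
-- with l = suc len ≥ 1, given by the sequence of vertices x₀,…,x_{l-1}.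
record Exchange {n t : ℕ} (c : EdgeColoring n t) (u v x₀ : Fin n) : Set where
  field
    len   : ℕ
    xs    : Fin (suc len) → Fin n
    start : xs Fin.zero ≡ x₀
    -- vx_i and x_i u are edges of K_n
    ≢v    : ∀ i → xs i ≢ v
    ≢u    : ∀ i → xs i ≢ u
    -- the 2l edges are distinct (given the above and u ≢ v, this is
    -- exactly injectivity of i ↦ x_i)
    inj   : Injective _≡_ _≡_ xs
    chain : ∀ i → col c (xs i) u ≡ col c v (xs (next i))
open Exchange public

_⊆X_ : ∀ {n t} {c : EdgeColoring n t} {u v x₀ : Fin n} →
       Exchange c u v x₀ → Exchange c u v x₀ → Set
L ⊆X L' = ∀ i → ∃ λ j → xs L i ≡ xs L' j

Simplified : ∀ {n t} {c : EdgeColoring n t} {u v x₀ : Fin n} →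
             Exchange c u v x₀ → Set
Simplified {c = c} {v = v} L =
  ∀ i j → col c v (xs L i) ≡ col c v (xs L j) → i ≡ j

-- Read an exchange as a closed walk x₀ → x₁ → ⋯ → x₀ in which the step from
-- x_i to x_{i+1} is allowed when colour(x_i u) = colour(v x_{i+1}).  If two
-- vertices of the walk share the colour of their edge to v, the walk can jump
-- directly to the later one, so repeatedly short-cutting yields a walk through
-- a subset of the vertices whose edges to v all have distinct colours.
module Submission where

open import Defs hiding (sym)
open import Data.Nat using (ℕ; suc; s≤s; _%_; _≤_)
open import Data.Nat.DivMod using (m<n⇒m%n≡m; n%n≡0)
open import Data.Nat.Properties using () renaming (_≟_ to _≟ℕ_)
open import Data.Empty using (⊥-elim)
open import Data.Fin using (Fin; zero; suc; toℕ; fromℕ; inject₁)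
open import Data.Fin.Properties using (toℕ-injective; toℕ-fromℕ<; toℕ-inject₁; toℕ-fromℕ; toℕ<n)
open import Data.Fin.Relation.Unary.Top using (view; ‵fromℕ; ‵inject₁)
open import Data.List using (List; []; _∷_; map; lookup; tabulate)
open import Data.List.Membership.Propositional.Properties using (∈-lookup; ∈-tabulate⁻)
open import Data.List.Relation.Binary.Subset.Propositional using (_⊆_)
open import Data.List.Relation.Binary.Subset.Propositional.Properties using (⊆-refl; ⊆-trans; xs⊆x∷xs; ∷⁺ʳ)
open import Data.List.Relation.Unary.All as All using ([]; _∷_)
open import Data.List.Relation.Unary.All.Properties using (¬Any⇒All¬)
open import Data.List.Relation.Unary.AllPairs as AllPairs using (AllPairs; []; _∷_)
import Data.List.Relation.Unary.AllPairs.Properties as AllPairsₚ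
open import Data.List.Relation.Unary.Any using (Any; here; there; any?)
import Data.List.Relation.Unary.Any.Properties as Any
open import Data.List.Relation.Unary.Unique.Propositional using (Unique)
open import Data.Product using (∃; _×_; _,_)
open import Function using (_∘_)
open import Function.Definitions using (Injective)
open import Relation.Binary.Definitions using (DecidableEquality)
open import Relation.Binary.PropositionalEquality using (_≡_; _≢_; refl; sym; trans; cong; subst; module ≡-Reasoning)
open import Relation.Nullary using (yes; no)

next-inject₁ : ∀ {k} (j : Fin k) → next (inject₁ j) ≡ suc j
next-inject₁ {k} j = toℕ-injective (begin
  toℕ (next (inject₁ j))        ≡⟨ toℕ-fromℕ< _ ⟩
  suc (toℕ (inject₁ j)) % suc k ≡⟨ cong (λ m → suc m % suc k) (toℕ-inject₁ j) ⟩
  suc (toℕ j) % suc k           ≡⟨ m<n⇒m%n≡m (s≤s (toℕ<n j)) ⟩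
  suc (toℕ j)                   ∎)
  where open ≡-Reasoning

next-fromℕ : ∀ k → next (fromℕ k) ≡ zero
next-fromℕ k = toℕ-injective (begin
  toℕ (next (fromℕ k))        ≡⟨ toℕ-fromℕ< _ ⟩
  suc (toℕ (fromℕ k)) % suc k ≡⟨ cong (λ m → suc m % suc k) (toℕ-fromℕ k) ⟩
  suc k % suc k               ≡⟨ n%n≡0 (suc k) ⟩
  0                           ∎)
  where open ≡-Reasoning

module ColourWalks {A C : Set} (_≟_ : DecidableEquality C) (enter leave : A → C) where

  Walk : C → List A → C → Set
  Walk k []      κ = k ≡ κ
  Walk k (y ∷ r) κ = k ≡ enter y × Walk (leave y) r κ

  Shortcut : C → List A → C → Set
  Shortcut k w κ = ∃ λ r → Walk k r κ × r ⊆ w × Unique (κ ∷ map enter r)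

  restart : ∀ {k k′ r κ} → Walk k′ r κ → Unique (κ ∷ map enter r) →
            Any (λ z → k ≡ enter z) r → Shortcut k r κ
  restart {r = y ∷ r} (_ , walk) uniq (here k≡y) = y ∷ r , (k≡y , walk) , ⊆-refl , uniq
  restart {r = y ∷ r} (_ , walk) ((_ ∷ κ∉r) ∷ (_ ∷ uniq)) (there p)
    with restart walk (κ∉r ∷ uniq) p
  ... | s , walk-s , s⊆r , uniq-s = s , walk-s , ⊆-trans s⊆r (xs⊆x∷xs r y) , uniq-s

  shortcut : ∀ {k w κ} → Walk k w κ → Shortcut k w κ
  shortcut {w = []} k≡κ = [] , k≡κ , ⊆-refl , [] ∷ []
  shortcut {w = y ∷ w} {κ} (refl , walk) with shortcut walk
  ... | r , walk-r , r⊆w , uniq with enter y ≟ κ | any? (enter y ≟_) (map enter r)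
  ... | yes y≡κ | _       = [] , y≡κ , (λ ()) , [] ∷ []
  ... | no _    | yes y∈r =
    let s , walk-s , s⊆r , uniq-s = restart walk-r uniq (Any.map⁻ y∈r)
    in  s , walk-s , ⊆-trans (⊆-trans s⊆r r⊆w) (xs⊆x∷xs w y) , uniq-s
  ... | no y≢κ  | no y∉r  =
    y ∷ r , (refl , walk-r) , ∷⁺ʳ y r⊆w ,
    ((y≢κ ∘ sym) ∷ AllPairs.head uniq) ∷ ¬Any⇒All¬ _ y∉r ∷ AllPairs.tail uniq

  walk-step : ∀ {a r κ} → Walk (leave a) r κ →
              ∀ j → leave (lookup (a ∷ r) (inject₁ j)) ≡ enter (lookup r j)
  walk-step {r = y ∷ r} (a→y , _)  zero    = a→y
  walk-step {r = y ∷ r} (_ , walk) (suc j) = walk-step walk j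

  walk-end : ∀ {a r κ} → Walk (leave a) r κ → leave (lookup (a ∷ r) (fromℕ _)) ≡ κ
  walk-end {r = []}    a→κ        = a→κ
  walk-end {r = y ∷ r} (_ , walk) = walk-end walk

  closedWalk⇒cycle : ∀ {a r} → Walk (leave a) r (enter a) →
                     ∀ i → leave (lookup (a ∷ r) i) ≡ enter (lookup (a ∷ r) (next i))
  closedWalk⇒cycle {a} {r} walk i with view i
  ... | ‵fromℕ     = trans (walk-end walk) (cong (enter ∘ lookup (a ∷ r)) (sym (next-fromℕ _)))
  ... | ‵inject₁ j = trans (walk-step walk j) (cong (enter ∘ lookup (a ∷ r)) (sym (next-inject₁ j)))

  path⇒walk : ∀ {m} (g : Fin (suc m) → A) → (∀ j → leave (g (inject₁ j)) ≡ enter (g (suc j))) →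
              Walk (leave (g zero)) (tabulate (g ∘ suc)) (leave (g (fromℕ m)))
  path⇒walk {0}     g steps = refl
  path⇒walk {suc m} g steps = steps zero , path⇒walk (g ∘ suc) (steps ∘ suc)

  cycle⇒closedWalk : ∀ {k} (f : Fin (suc k) → A) → (∀ i → leave (f i) ≡ enter (f (next i))) →
                     Walk (leave (f zero)) (tabulate (f ∘ suc)) (enter (f zero))
  cycle⇒closedWalk {k} f cycle = subst (Walk _ _)
    (trans (cycle (fromℕ k)) (cong (enter ∘ f) (next-fromℕ k)))
    (path⇒walk f (λ j → trans (cycle (inject₁ j)) (cong (enter ∘ f) (next-inject₁ j))))

unique-map⇒lookup-injective : ∀ {A B : Set} (f : A → B) {xs : List A} →
                              Unique (map f xs) → Injective _≡_ _≡_ (f ∘ lookup xs)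
unique-map⇒lookup-injective f uniq = go (AllPairsₚ.map⁻ uniq)
  where
  go : ∀ {xs} → AllPairs (λ x y → f x ≢ f y) xs →
       Injective _≡_ _≡_ (f ∘ lookup xs)
  go {x ∷ xs} _          {zero}  {zero}  _ = refl
  go {x ∷ xs} (x∉ ∷ _)    {zero}  {suc j} e = ⊥-elim (All.lookup x∉ (∈-lookup j) e)
  go {x ∷ xs} (x∉ ∷ _)    {suc i} {zero}  e = ⊥-elim (All.lookup x∉ (∈-lookup i) (sym e))
  go {x ∷ xs} (_ ∷ uniq) {suc i} {suc j} e = cong suc (go uniq e)

module ExchangeShortcuts {n t : ℕ} (c : EdgeColoring n t) (u v : Fin n) where

  open ColourWalks _≟ℕ_ (col c v) (λ x → col c x u)

  lookup-∷-tabulate⁻ : ∀ {x₀} (L : Exchange c u v x₀) {r} → r ⊆ tabulate (xs L ∘ suc) →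
                       ∀ i → ∃ λ k → lookup (xs L zero ∷ r) i ≡ xs L k
  lookup-∷-tabulate⁻ L r⊆ i = ∈-tabulate⁻ (∷⁺ʳ (xs L zero) r⊆ (∈-lookup i))

  shortened : ∀ {x₀} (L : Exchange c u v x₀) (r : List (Fin n)) →
              let x = xs L zero in
              Walk (col c x u) r (col c v x) → r ⊆ tabulate (xs L ∘ suc) →
              Unique (map (col c v) (x ∷ r)) → Exchange c u v x₀
  shortened L r walk r⊆ uniq = record
    { len   = _
    ; xs    = lookup (xs L zero ∷ r)
    ; start = start L
    ; ≢v    = λ i → let k , eq = lookup-∷-tabulate⁻ L r⊆ i in subst (_≢ v) (sym eq) (≢v L k)
    ; ≢u    = λ i → let k , eq = lookup-∷-tabulate⁻ L r⊆ i in subst (_≢ u) (sym eq) (≢u L k)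
    ; inj   = λ eq → unique-map⇒lookup-injective (col c v) uniq (cong (col c v) eq)
    ; chain = closedWalk⇒cycle walk
    }

  exchange-shortcut : ∀ {x₀} (L : Exchange c u v x₀) →
                      ∃ λ (L' : Exchange c u v x₀) → Simplified L' × (L' ⊆X L)
  exchange-shortcut L with shortcut (cycle⇒closedWalk (xs L) (chain L))
  ... | r , walk , r⊆ , uniq =
    shortened L r walk r⊆ uniq ,
    (λ i j → unique-map⇒lookup-injective (col c v) uniq) ,
    lookup-∷-tabulate⁻ L r⊆

lemma3p1 : (n t : ℕ) → 2 ≤ t → (c : EdgeColoring n t) →
           ((j : ℕ) → 3 ≤ j → j ≤ t → IsRegularClass c j) →
           (u v x₀ : Fin n) → u ≢ v → u ≢ x₀ → v ≢ x₀ →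
           col c v x₀ ≡ 1 → col c x₀ u ≢ 1 →
           (L : Exchange c u v x₀) →
           ∃ λ (L' : Exchange c u v x₀) → Simplified L' × (L' ⊆X L)
lemma3p1 n t _ c _ u v x₀ _ _ _ _ _ = ExchangeShortcuts.exchange-shortcut c u v
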